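{- For $m\ge1$ and variables $y_1,\dots,y_m$, let \[ \hat B_m(y_1,\dots,y_m)=\sum_{\pi\in S_m}\ \prod_{v\in\mathrm{PKV}(\pi)}y_v . \] Then for every $n\ge2$, \[ \hat B_n(x_1,\dots,x_n)=2\hat B_{n-1}(x_1,\dots,x_{n-1})+x_n\sum_{k=2}^{n-1}\ \sum_{\substack{T\subseteq[n-1]\\|T|=k-1}}\hat B_{k-1}(x_{t_1},\dots,x_{t_{k-1}})\,\hat B_{n-k}(x_{s_1},\dots,x_{s_{n-k}}), \] where $T=\{t_1<\dots<t_{k-1}\}$ and $[n-1]\setminus T=\{s_1<\dots<s_{n-k}\}$.
   Context: For $\pi\in S_m$ in one-line notation, an index $i$ with $1<i<m$ is a peak if $\pi(i-1)<\pi(i)>\pi(i+1)$, and then $\pi(i)$ is a peak-value; $\mathrm{PKV}(\pi)$ is the set of peak-values of $\pi$. -}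

module Defs where

open import Level using (Level)
open import Data.Bool using (Bool; true; false; _∧_; if_then_else_)
open import Data.Nat using (ℕ; zero; suc; _∸_)
import Data.Nat as N
open import Data.Fin using (Fin; _<?_)
open import Data.List using (List; []; _∷_; map; concatMap; allFin; filter; length; lookup; foldr; applyUpTo)
open import Data.Product using (_×_; _,_)
open import Relation.Nullary using (does)
open import Algebra.Bundles using (CommutativeSemiring)
import Data.Fin.Properties as FinP
import Data.List.Relation.Unary.Unique.DecPropositional as UDP

words : (k m : ℕ) → List (List (Fin m))
words zero    m = [] ∷ []
words (suc k) m = concatMap (λ w → map (λ a → a ∷ w) (allFin m)) (words k m)

-- The symmetric group S_m, in one-line notation: all words of length m over
-- Fin m (values 0..m-1 standing for 1..m) with pairwise distinct letters.
perms : (m : ℕ) → List (List (Fin m))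
perms m = filter (UDP.unique? (FinP._≟_ {m})) (words m m)

interval : ℕ → ℕ → List ℕ
interval a n = applyUpTo (λ i → a N.+ i) n

subsetsWithCompl : {A : Set} → List A → List (List A × List A)
subsetsWithCompl []       = ([] , []) ∷ []
subsetsWithCompl (a ∷ as) =
  concatMap (λ p → let T = Data.Product.proj₁ p ; S = Data.Product.proj₂ p
                   in (a ∷ T , S) ∷ (T , a ∷ S) ∷ [])
            (subsetsWithCompl as)

module WithSemiring {c ℓ : Level} (R : CommutativeSemiring c ℓ) where
  open CommutativeSemiring R

  sumL : List Carrier → Carrier
  sumL = foldr _+_ 0#

  -- Product of y_v over the peak-values v of a word.  In a permutation the
  -- letters are distinct, so the product over peak positions equals the
  -- product over the set PKV.
  peakProd : {m : ℕ} → (Fin m → Carrier) → List (Fin m) → Carrier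
  peakProd y (a ∷ b ∷ c ∷ rest) =
    (if does (a <? b) ∧ does (c <? b) then y b else 1#) * peakProd y (b ∷ c ∷ rest)
  peakProd y _ = 1#

  Bhat : List Carrier → Carrier
  Bhat ys = sumL (map (peakProd (lookup ys)) (perms (length ys)))

-- Write a permutation of {1, …, n} as u n v.  As n is the largest letter, its neighbours are
-- never peaks, peaks inside u and inside v are unaffected, and n itself is a peak iff u and v
-- are both nonempty.  Grouping S_n by the sets T and S of letters of u and v therefore gives
-- B̂(T) B̂(S) x_n for every split with T, S ≠ ∅, and B̂_{n-1} for each of the splits T = ∅ and
-- S = ∅.  Peak products depend only on the relative order of the letters, so B̂ of the
-- variables indexed by an increasing list T is computed on the permutations of T itself; and
-- summing over k the indicator of |T| = k - 1 selects exactly the splits with T, S ≠ ∅.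

module Submission where

open import Defs
open import Level using (Level)
open import Data.Bool using (Bool; true; false; not; _∧_; if_then_else_)
open import Data.Bool.Properties using (∧-zeroʳ)
open import Data.Nat using (ℕ; zero; suc; _∸_; _<_; _≤_; _<?_; _≡ᵇ_; z≤n; s≤s; z<s; s<s)
import Data.Nat as ℕ
import Data.Nat.Properties as ℕₚ
open import Data.Fin using (Fin)
import Data.Fin as Fin
import Data.Fin.Properties as Finₚ
open import Data.List using (List; allFin; []; _∷_; [_]; _++_; map; concatMap; filter; length; lookup; null; tabulate)
open import Data.List.Properties
  using (map-∘; map-cong-local; map-++; length-map; map-tabulate; length-++; filter-all; filter-accept; filter-reject;
         applyUpTo-∷ʳ; length-applyUpTo)
open import Data.List.Relation.Unary.All as All using (All; []; _∷_)
import Data.List.Relation.Unary.All.Properties as All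
open import Data.List.Relation.Unary.AllPairs using (AllPairs; []; _∷_)
import Data.List.Relation.Unary.AllPairs.Properties as AllPairs
open import Data.List.Relation.Unary.Unique.Propositional using (Unique)
import Data.List.Relation.Unary.Unique.Propositional.Properties as Unique
import Data.List.Relation.Unary.Unique.DecPropositional as UniqueDec
open import Data.Product using (_×_; _,_; proj₁; proj₂; map₂)
open import Data.Sum using (_⊎_; inj₁; inj₂)
import Data.Sum as ⊎
open import Function using (_∘_; id; mk⇔)
open import Relation.Binary using (DecidableEquality; tri<; tri≈; tri>)
open import Relation.Binary.PropositionalEquality as ≡ using (_≡_; _≢_)
open import Relation.Nullary using (does; ¬?; contradiction)
open import Relation.Nullary.Decidable using (dec-true; dec-false; does-⇔)
open import Relation.Unary using () renaming (Decidable to Decidable₁)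
open import Algebra.Bundles using (CommutativeSemiring)

private variable
  X Y : Set

picks : List X → List (X × List X)
picks []      = []
picks (a ∷ A) = (a , A) ∷ map (map₂ (a ∷_)) (picks A)

arrangements : ℕ → List X → List (List X)
arrangements zero    A = [ [] ]
arrangements (suc k) A = concatMap (λ p → map (proj₁ p ∷_) (arrangements k (proj₂ p))) (picks A)

permutations : List X → List (List X)
permutations A = arrangements (length A) A

wordsOver : ℕ → List X → List (List X)
wordsOver zero    A = [ [] ]
wordsOver (suc k) A = concatMap (λ w → map (_∷ w) A) (wordsOver k A)

words≡wordsOver : (k m : ℕ) → words k m ≡ wordsOver k (allFin m)
words≡wordsOver zero    m = ≡.refl
words≡wordsOver (suc k) m = ≡.cong (concatMap (λ w → map (_∷ w) (allFin m))) (words≡wordsOver k m)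

picks-map : (g : X → Y) (A : List X) →
            picks (map g A) ≡ map (λ p → g (proj₁ p) , map g (proj₂ p)) (picks A)
picks-map g []      = ≡.refl
picks-map g (a ∷ A) = ≡.cong ((g a , map g A) ∷_) (begin
  map (map₂ (g a ∷_)) (picks (map g A))                          ≡⟨ ≡.cong (map _) (picks-map g A) ⟩
  map (map₂ (g a ∷_)) (map _ (picks A))                          ≡⟨ map-∘ (picks A) ⟨
  map (λ p → g (proj₁ p) , g a ∷ map g (proj₂ p)) (picks A)       ≡⟨ map-∘ (picks A) ⟩
  map _ (map (map₂ (a ∷_)) (picks A))                            ∎)
  where open ≡.≡-Reasoning

picks-∷ʳ : (A : List X) (b : X) → picks (A ++ [ b ]) ≡ map (map₂ (_++ [ b ])) (picks A) ++ [ (b , A) ]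
picks-∷ʳ []      b = ≡.refl
picks-∷ʳ (a ∷ A) b = ≡.cong ((a , A ++ [ b ]) ∷_) (begin
  map (map₂ (a ∷_)) (picks (A ++ [ b ]))                                       ≡⟨ ≡.cong (map _) (picks-∷ʳ A b) ⟩
  map (map₂ (a ∷_)) (map (map₂ (_++ [ b ])) (picks A) ++ [ (b , A) ])          ≡⟨ map-++ _ _ [ (b , A) ] ⟩
  map (map₂ (a ∷_)) (map (map₂ (_++ [ b ])) (picks A)) ++ [ (b , a ∷ A) ]      ≡⟨ ≡.cong (_++ _) (map-∘ (picks A)) ⟨
  map (λ p → proj₁ p , a ∷ proj₂ p ++ [ b ]) (picks A) ++ [ (b , a ∷ A) ]       ≡⟨ ≡.cong (_++ _) (map-∘ (picks A)) ⟩
  map (map₂ (_++ [ b ])) (map (map₂ (a ∷_)) (picks A)) ++ [ (b , a ∷ A) ]      ∎)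
  where open ≡.≡-Reasoning

picks-length : (A : List X) → All (λ p → suc (length (proj₂ p)) ≡ length A) (picks A)
picks-length []      = []
picks-length (a ∷ A) = ≡.refl ∷ All.map⁺ (All.map (≡.cong suc) (picks-length A))

picks-All : {P : X → Set} {A : List X} → All P A → All (λ p → P (proj₁ p) × All P (proj₂ p)) (picks A)
picks-All []         = []
picks-All (pa ∷ pas) = (pa , pas) ∷ All.map⁺ (All.map (map₂ (pa ∷_)) (picks-All pas))

All-concatMap⁺ : {P : Y → Set} {f : X → List Y} {A : List X} → All (All P ∘ f) A → All P (concatMap f A)
All-concatMap⁺ = All.concat⁺ ∘ All.map⁺

arrangements-All : {P : X → Set} (k : ℕ) {A : List X} → All P A → All (All P) (arrangements k A)
arrangements-All zero    pas = [] ∷ []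
arrangements-All (suc k) pas =
  All-concatMap⁺ (All.map (λ (pa , prest) → All.map⁺ (All.map (pa ∷_) (arrangements-All k prest))) (picks-All pas))

arrangements-nonempty : (k : ℕ) (A : List X) → All (λ u → null u ≡ false) (arrangements (suc k) A)
arrangements-nonempty k A =
  All-concatMap⁺ (All.universal (λ p → All.map⁺ (All.universal (λ _ → ≡.refl) _)) (picks A))

subsetsWithCompl-All : {P : X → Set} {A : List X} → All P A →
                       All (λ q → All P (proj₁ q) × All P (proj₂ q)) (subsetsWithCompl A)
subsetsWithCompl-All []         = ([] , []) ∷ []
subsetsWithCompl-All (pa ∷ pas) =
  All-concatMap⁺ (All.map (λ (pT , pS) → (pa ∷ pT , pS) ∷ (pT , pa ∷ pS) ∷ []) (subsetsWithCompl-All pas))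

subsetsWithCompl-AllPairs : {R : X → X → Set} {A : List X} → AllPairs R A →
                            All (λ q → AllPairs R (proj₁ q) × AllPairs R (proj₂ q)) (subsetsWithCompl A)
subsetsWithCompl-AllPairs []         = ([] , []) ∷ []
subsetsWithCompl-AllPairs (ra ∷ ras) = All-concatMap⁺ (All.map
  (λ ((rT , rS) , (raT , raS)) → (raT ∷ rT , rS) ∷ (rT , raS ∷ rS) ∷ [])
  (All.zip (subsetsWithCompl-AllPairs ras , subsetsWithCompl-All ra)))

subsetsWithCompl-length : (A : List X) →
                          All (λ q → length (proj₁ q) ℕ.+ length (proj₂ q) ≡ length A) (subsetsWithCompl A)
subsetsWithCompl-length []      = ≡.refl ∷ []
subsetsWithCompl-length (a ∷ A) = All-concatMap⁺ (All.map
  (λ {q} e → ≡.cong suc e ∷ ≡.trans (ℕₚ.+-suc (length (proj₁ q)) _) (≡.cong suc e) ∷ [])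
  (subsetsWithCompl-length A))

interval-sorted : (a m : ℕ) → AllPairs _<_ (interval a m)
interval-sorted a m = AllPairs.applyUpTo⁺₁ (a ℕ.+_) m (λ i<j _ → ℕₚ.+-monoʳ-< a i<j)

module Sums {c ℓ : Level} (R : CommutativeSemiring c ℓ) where
  open CommutativeSemiring R
  open WithSemiring R using (sumL)
  open import Algebra.Properties.CommutativeSemigroup +-commutativeSemigroup using () renaming (interchange to +-interchange)
  open import Relation.Binary.Reasoning.Setoid setoid

  ∑ : List X → (X → Carrier) → Carrier
  ∑ l f = sumL (map f l)

  [_]·_ : Bool → Carrier → Carrier
  [ b ]· v = if b then v else 0#

  [∧]· : (b₁ b₂ : Bool) (v : Carrier) → [ b₁ ∧ b₂ ]· v ≡ [ b₁ ]· [ b₂ ]· v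
  [∧]· true  b₂ v = ≡.refl
  [∧]· false b₂ v = ≡.refl

  ∑-congᴬ : {f g : X → Carrier} {l : List X} → All (λ a → f a ≈ g a) l → ∑ l f ≈ ∑ l g
  ∑-congᴬ []       = refl
  ∑-congᴬ (p ∷ ps) = +-cong p (∑-congᴬ ps)

  ∑-cong : {f g : X → Carrier} (l : List X) → (∀ a → f a ≈ g a) → ∑ l f ≈ ∑ l g
  ∑-cong l f≈g = ∑-congᴬ (All.universal f≈g l)

  ∑-map : (h : X → Y) (l : List X) (f : Y → Carrier) → ∑ (map h l) f ≡ ∑ l (f ∘ h)
  ∑-map h l f = ≡.cong sumL (≡.sym (map-∘ l))

  ∑-++ : (l m : List X) (f : X → Carrier) → ∑ (l ++ m) f ≈ ∑ l f + ∑ m f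
  ∑-++ []      m f = sym (+-identityˡ _)
  ∑-++ (a ∷ l) m f = trans (+-cong refl (∑-++ l m f)) (sym (+-assoc _ _ _))

  ∑-concatMap : (h : X → List Y) (l : List X) (f : Y → Carrier) →
                ∑ (concatMap h l) f ≈ ∑ l (λ a → ∑ (h a) f)
  ∑-concatMap h []      f = refl
  ∑-concatMap h (a ∷ l) f = trans (∑-++ (h a) _ f) (+-cong refl (∑-concatMap h l f))

  ∑-zero : (l : List X) → ∑ l (λ _ → 0#) ≈ 0#
  ∑-zero []      = refl
  ∑-zero (a ∷ l) = trans (+-identityˡ _) (∑-zero l)

  ∑-+ : (l : List X) (f g : X → Carrier) → ∑ l (λ a → f a + g a) ≈ ∑ l f + ∑ l g
  ∑-+ []      f g = sym (+-identityˡ _)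
  ∑-+ (a ∷ l) f g = trans (+-cong refl (∑-+ l f g)) (+-interchange _ _ _ _)

  ∑-*ˡ : (k : Carrier) (l : List X) (f : X → Carrier) → k * ∑ l f ≈ ∑ l (λ a → k * f a)
  ∑-*ˡ k []      f = zeroʳ k
  ∑-*ˡ k (a ∷ l) f = trans (distribˡ k _ _) (+-cong refl (∑-*ˡ k l f))

  ∑-*ʳ : (k : Carrier) (l : List X) (f : X → Carrier) → ∑ l f * k ≈ ∑ l (λ a → f a * k)
  ∑-*ʳ k l f = trans (*-comm _ _) (trans (∑-*ˡ k l f) (∑-cong l (λ _ → *-comm _ _)))

  ∑-swap : (l : List X) (m : List Y) (f : X → Y → Carrier) →
           ∑ l (λ a → ∑ m (f a)) ≈ ∑ m (λ b → ∑ l (λ a → f a b))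
  ∑-swap []      m f = sym (∑-zero m)
  ∑-swap (a ∷ l) m f = trans (+-cong refl (∑-swap l m f)) (sym (∑-+ m (f a) _))

  ∑-filter : {P : X → Set} (P? : Decidable₁ P) (l : List X) (f : X → Carrier) →
             ∑ (filter P? l) f ≈ ∑ l (λ a → [ does (P? a) ]· f a)
  ∑-filter P? []      f = refl
  ∑-filter P? (a ∷ l) f with does (P? a)
  ... | true  = +-cong refl (∑-filter P? l f)
  ... | false = trans (∑-filter P? l f) (sym (+-identityˡ _))

  ∑-[]· : (b : Bool) (l : List X) (f : X → Carrier) → ∑ l (λ a → [ b ]· f a) ≈ [ b ]· ∑ l f
  ∑-[]· true  l f = refl
  ∑-[]· false l f = ∑-zero l

  [≡ᵇ]·-≢ : {i j : ℕ} (v : Carrier) → i ≢ j → [ i ≡ᵇ j ]· v ≡ 0#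
  [≡ᵇ]·-≢ {i} {j} v i≢j = ≡.cong (λ b → [ b ]· v) (dec-false (i ℕ.≟ j) i≢j)

  [≡ᵇ]·-refl : (i : ℕ) (v : Carrier) → [ i ≡ᵇ i ]· v ≡ v
  [≡ᵇ]·-refl i v = ≡.cong (λ b → [ b ]· v) (dec-true (i ℕ.≟ i) ≡.refl)

  ∑-interval-∷ʳ : (a m : ℕ) (h : ℕ → Carrier) →
                  ∑ (interval a (suc m)) h ≈ ∑ (interval a m) h + h (a ℕ.+ m)
  ∑-interval-∷ʳ a m h = trans (reflexive (≡.cong (λ l → ∑ l h) (≡.sym (applyUpTo-∷ʳ (a ℕ.+_) m))))
                              (trans (∑-++ (interval a m) _ h) (+-cong refl (+-identityʳ _)))

  ∑-interval-[≡ᵇ]-outside : {j a : ℕ} (m : ℕ) (v : Carrier) → j < a ⊎ a ℕ.+ m ≤ j →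
                            ∑ (interval (suc a) m) (λ i → [ j ≡ᵇ i ∸ 1 ]· v) ≈ 0#
  ∑-interval-[≡ᵇ]-outside zero    v _ = refl
  ∑-interval-[≡ᵇ]-outside {j} {a} (suc m) v outside = begin
    ∑ (interval (suc a) (suc m)) (λ i → [ j ≡ᵇ i ∸ 1 ]· v) ≈⟨ ∑-interval-∷ʳ (suc a) m _ ⟩
    ∑ (interval (suc a) m) (λ i → [ j ≡ᵇ i ∸ 1 ]· v) + [ j ≡ᵇ a ℕ.+ m ]· v
      ≈⟨ +-cong (∑-interval-[≡ᵇ]-outside m v (⊎.map₂ (ℕₚ.<⇒≤ ∘ a+m<j) outside))
                (reflexive ([≡ᵇ]·-≢ v (j≢a+m outside))) ⟩
    0# + 0#
      ≈⟨ +-identityˡ 0# ⟩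
    0# ∎
    where
    a+m<j : a ℕ.+ suc m ≤ j → a ℕ.+ m < j
    a+m<j = ≡.subst (_≤ j) (ℕₚ.+-suc a m)
    j≢a+m : j < a ⊎ a ℕ.+ suc m ≤ j → j ≢ a ℕ.+ m
    j≢a+m (inj₁ j<a)     = ℕₚ.<⇒≢ (ℕₚ.<-≤-trans j<a (ℕₚ.m≤m+n a m))
    j≢a+m (inj₂ a+1+m≤j) = ℕₚ.>⇒≢ (a+m<j a+1+m≤j)

  ∑-interval-[≡ᵇ]-inside : {j a : ℕ} (m : ℕ) (v : Carrier) → a ≤ j → j < a ℕ.+ m →
                           ∑ (interval (suc a) m) (λ i → [ j ≡ᵇ i ∸ 1 ]· v) ≈ v
  ∑-interval-[≡ᵇ]-inside {j} {a} zero    v a≤j j<a+0 =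
    contradiction (≡.subst (j <_) (ℕₚ.+-identityʳ a) j<a+0) (ℕₚ.≤⇒≯ a≤j)
  ∑-interval-[≡ᵇ]-inside {j} {a} (suc m) v a≤j j<a+1+m = trans (∑-interval-∷ʳ (suc a) m _)
    (lastOrEarlier (ℕₚ.m<1+n⇒m<n∨m≡n (≡.subst (j <_) (ℕₚ.+-suc a m) j<a+1+m)))
    where
    lastOrEarlier : j < a ℕ.+ m ⊎ j ≡ a ℕ.+ m →
                    ∑ (interval (suc a) m) (λ i → [ j ≡ᵇ i ∸ 1 ]· v) + [ j ≡ᵇ a ℕ.+ m ]· v ≈ v
    lastOrEarlier (inj₁ j<a+m) = trans
      (+-cong (∑-interval-[≡ᵇ]-inside m v a≤j j<a+m) (reflexive ([≡ᵇ]·-≢ v (ℕₚ.<⇒≢ j<a+m))))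
      (+-identityʳ v)
    lastOrEarlier (inj₂ ≡.refl) = trans
      (+-cong (∑-interval-[≡ᵇ]-outside m v (inj₂ ℕₚ.≤-refl)) (reflexive ([≡ᵇ]·-refl j v)))
      (+-identityˡ v)

module Arrangements {c ℓ : Level} (R : CommutativeSemiring c ℓ) where
  open CommutativeSemiring R
  open Sums R
  open import Relation.Binary.Reasoning.Setoid setoid

  ∑-arrangements-suc : (k : ℕ) (A : List X) (f : List X → Carrier) →
                       ∑ (arrangements (suc k) A) f
                         ≈ ∑ (picks A) (λ p → ∑ (arrangements k (proj₂ p)) (f ∘ (proj₁ p ∷_)))
  ∑-arrangements-suc k A f = trans (∑-concatMap _ (picks A) f)
    (∑-cong (picks A) (λ p → reflexive (∑-map (proj₁ p ∷_) (arrangements k (proj₂ p)) f)))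

  ∑-arrangements-map : (g : X → Y) (k : ℕ) (A : List X) (F : List Y → Carrier) →
                       ∑ (arrangements k (map g A)) F ≈ ∑ (arrangements k A) (F ∘ map g)
  ∑-arrangements-map g zero    A F = refl
  ∑-arrangements-map g (suc k) A F = begin
    ∑ (arrangements (suc k) (map g A)) F
      ≈⟨ ∑-arrangements-suc k (map g A) F ⟩
    ∑ (picks (map g A)) (λ p → ∑ (arrangements k (proj₂ p)) (F ∘ (proj₁ p ∷_)))
      ≡⟨ ≡.cong (λ l → ∑ l (λ p → ∑ (arrangements k (proj₂ p)) (F ∘ (proj₁ p ∷_)))) (picks-map g A) ⟩
    ∑ (map _ (picks A)) (λ p → ∑ (arrangements k (proj₂ p)) (F ∘ (proj₁ p ∷_)))
      ≡⟨ ∑-map _ (picks A) _ ⟩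
    ∑ (picks A) (λ p → ∑ (arrangements k (map g (proj₂ p))) (F ∘ (g (proj₁ p) ∷_)))
      ≈⟨ ∑-cong (picks A) (λ p → ∑-arrangements-map g k (proj₂ p) _) ⟩
    ∑ (picks A) (λ p → ∑ (arrangements k (proj₂ p)) (F ∘ map g ∘ (proj₁ p ∷_)))
      ≈⟨ ∑-arrangements-suc k A _ ⟨
    ∑ (arrangements (suc k) A) (F ∘ map g) ∎

  ∑-permutations : (T : List X) (h : List X → Carrier) →
                   ∑ (permutations T) h
                     ≈ [ null T ]· h [] + ∑ (picks T) (λ p → ∑ (permutations (proj₂ p)) (h ∘ (proj₁ p ∷_)))
  ∑-permutations []      h = refl
  ∑-permutations (t ∷ T) h = begin
    ∑ (permutations (t ∷ T)) h
      ≈⟨ ∑-arrangements-suc (length T) (t ∷ T) h ⟩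
    ∑ (picks (t ∷ T)) (λ p → ∑ (arrangements (length T) (proj₂ p)) (h ∘ (proj₁ p ∷_)))
      ≈⟨ ∑-congᴬ (All.map (λ {p} |p|≡|T| → reflexive (≡.cong (λ k → ∑ (arrangements k (proj₂ p)) _)
                                                             (ℕₚ.suc-injective (≡.sym |p|≡|T|))))
                           (picks-length (t ∷ T))) ⟩
    ∑ (picks (t ∷ T)) (λ p → ∑ (permutations (proj₂ p)) (h ∘ (proj₁ p ∷_)))
      ≈⟨ +-identityˡ _ ⟨
    0# + ∑ (picks (t ∷ T)) (λ p → ∑ (permutations (proj₂ p)) (h ∘ (proj₁ p ∷_))) ∎

  ∑-subsetsWithCompl-∷ : (b : X) (A : List X) (h : List X × List X → Carrier) →
                         ∑ (subsetsWithCompl (b ∷ A)) h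
                           ≈ ∑ (subsetsWithCompl A) (λ q → h (b ∷ proj₁ q , proj₂ q))
                             + ∑ (subsetsWithCompl A) (λ q → h (proj₁ q , b ∷ proj₂ q))
  ∑-subsetsWithCompl-∷ b A h = trans (∑-concatMap _ (subsetsWithCompl A) h)
    (trans (∑-cong (subsetsWithCompl A) (λ _ → +-cong refl (+-identityʳ _))) (∑-+ (subsetsWithCompl A) _ _))

  ∑-subsetsWithCompl-null₁ : (A : List X) (K : List X → Carrier) →
                             ∑ (subsetsWithCompl A) (λ q → [ null (proj₁ q) ]· K (proj₂ q)) ≈ K A
  ∑-subsetsWithCompl-null₁ []      K = +-identityʳ _
  ∑-subsetsWithCompl-null₁ (b ∷ A) K = trans (∑-subsetsWithCompl-∷ b A _)
    (trans (+-cong (∑-zero (subsetsWithCompl A)) refl)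
           (trans (+-identityˡ _) (∑-subsetsWithCompl-null₁ A (K ∘ (b ∷_)))))

  ∑-subsetsWithCompl-null₂ : (A : List X) (K : List X → Carrier) →
                             ∑ (subsetsWithCompl A) (λ q → [ null (proj₂ q) ]· K (proj₁ q)) ≈ K A
  ∑-subsetsWithCompl-null₂ []      K = +-identityʳ _
  ∑-subsetsWithCompl-null₂ (b ∷ A) K = trans (∑-subsetsWithCompl-∷ b A _)
    (trans (+-cong refl (∑-zero (subsetsWithCompl A)))
           (trans (+-identityʳ _) (∑-subsetsWithCompl-null₂ A (K ∘ (b ∷_)))))

  ∑-subsetsWithCompl-picks : (A : List X) (G : X → List X → List X → Carrier) →
    ∑ (subsetsWithCompl A) (λ q → ∑ (picks (proj₁ q)) (λ p → G (proj₁ p) (proj₂ p) (proj₂ q)))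
      ≈ ∑ (picks A) (λ p → ∑ (subsetsWithCompl (proj₂ p)) (λ q → G (proj₁ p) (proj₁ q) (proj₂ q)))
  ∑-subsetsWithCompl-picks []      G = +-identityʳ _
  ∑-subsetsWithCompl-picks (b ∷ A) G = begin
    ∑ (subsets (b ∷ A)) (λ q → ∑ (picks (proj₁ q)) (λ p → G (proj₁ p) (proj₂ p) (proj₂ q)))
      ≈⟨ ∑-subsetsWithCompl-∷ b A _ ⟩
    ∑ (subsets A) (λ q → G b (proj₁ q) (proj₂ q)
                          + ∑ (map _ (picks (proj₁ q))) (λ p → G (proj₁ p) (proj₂ p) (proj₂ q)))
      + ∑ (subsets A) (λ q → ∑ (picks (proj₁ q)) (λ p → G (proj₁ p) (proj₂ p) (b ∷ proj₂ q)))
      ≈⟨ +-cong (trans (∑-cong (subsets A) (λ q → +-cong refl (reflexive (∑-map _ (picks (proj₁ q)) _))))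
                       (∑-+ (subsets A) _ _))
                refl ⟩
    ∑ (subsets A) (λ q → G b (proj₁ q) (proj₂ q))
      + ∑ (subsets A) (λ q → ∑ (picks (proj₁ q)) (λ p → G (proj₁ p) (b ∷ proj₂ p) (proj₂ q)))
      + ∑ (subsets A) (λ q → ∑ (picks (proj₁ q)) (λ p → G (proj₁ p) (proj₂ p) (b ∷ proj₂ q)))
      ≈⟨ +-assoc _ _ _ ⟩
    ∑ (subsets A) (λ q → G b (proj₁ q) (proj₂ q))
      + (∑ (subsets A) (λ q → ∑ (picks (proj₁ q)) (λ p → G (proj₁ p) (b ∷ proj₂ p) (proj₂ q)))
         + ∑ (subsets A) (λ q → ∑ (picks (proj₁ q)) (λ p → G (proj₁ p) (proj₂ p) (b ∷ proj₂ q))))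
      ≈⟨ +-cong refl (+-cong (∑-subsetsWithCompl-picks A (λ a T S → G a (b ∷ T) S))
                               (∑-subsetsWithCompl-picks A (λ a T S → G a T (b ∷ S)))) ⟩
    ∑ (subsets A) (λ q → G b (proj₁ q) (proj₂ q))
      + (∑ (picks A) (λ p → ∑ (subsets (proj₂ p)) (λ q → G (proj₁ p) (b ∷ proj₁ q) (proj₂ q)))
         + ∑ (picks A) (λ p → ∑ (subsets (proj₂ p)) (λ q → G (proj₁ p) (proj₁ q) (b ∷ proj₂ q))))
      ≈⟨ +-cong refl (trans (∑-cong (picks A) (λ p → ∑-subsetsWithCompl-∷ b (proj₂ p) _)) (∑-+ (picks A) _ _)) ⟨
    ∑ (subsets A) (λ q → G b (proj₁ q) (proj₂ q))
      + ∑ (picks A) (λ p → ∑ (subsets (b ∷ proj₂ p)) (λ q → G (proj₁ p) (proj₁ q) (proj₂ q)))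
      ≡⟨ ≡.cong (∑ (subsets A) (λ q → G b (proj₁ q) (proj₂ q)) +_) (∑-map (map₂ (b ∷_)) (picks A) _) ⟨
    ∑ (picks (b ∷ A)) (λ p → ∑ (subsets (proj₂ p)) (λ q → G (proj₁ p) (proj₁ q) (proj₂ q))) ∎
    where subsets = subsetsWithCompl

  insertionSum : X → List X → (List X → Carrier) → Carrier
  insertionSum b A f = ∑ (subsetsWithCompl A) (λ q →
    ∑ (permutations (proj₁ q)) (λ u → ∑ (permutations (proj₂ q)) (λ v → f (u ++ b ∷ v))))

  ∑-arrangements-∷ʳ : {X : Set} (b : X) (k : ℕ) {A : List X} → length A ≡ k → (f : List X → Carrier) →
                      ∑ (arrangements (suc k) (A ++ [ b ])) f ≈ insertionSum b A f
  ∑-arrangements-∷ʳ {X} b k {A} |A|≡k f = begin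
    ∑ (arrangements (suc k) (A ++ [ b ])) f
      ≈⟨ ∑-arrangements-suc k (A ++ [ b ]) f ⟩
    ∑ (picks (A ++ [ b ])) (λ p → ∑ (arrangements k (proj₂ p)) (f ∘ (proj₁ p ∷_)))
      ≡⟨ ≡.cong (λ l → ∑ l (λ p → ∑ (arrangements k (proj₂ p)) (f ∘ (proj₁ p ∷_)))) (picks-∷ʳ A b) ⟩
    ∑ (map _ (picks A) ++ [ (b , A) ]) (λ p → ∑ (arrangements k (proj₂ p)) (f ∘ (proj₁ p ∷_)))
      ≈⟨ ∑-++ (map _ (picks A)) _ _ ⟩
    ∑ (map _ (picks A)) (λ p → ∑ (arrangements k (proj₂ p)) (f ∘ (proj₁ p ∷_)))
      + (∑ (arrangements k A) (f ∘ (b ∷_)) + 0#)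
      ≈⟨ +-cong (trans (reflexive (∑-map _ (picks A) _)) (∑-congᴬ (All.map (insertInRest k |A|≡k) (picks-length A))))
                (trans (+-identityʳ _) (reflexive (≡.cong (λ j → ∑ (arrangements j A) (f ∘ (b ∷_))) (≡.sym |A|≡k)))) ⟩
    ∑ (picks A) (λ p → insertionSum b (proj₂ p) (f ∘ (proj₁ p ∷_))) + ∑ (permutations A) (f ∘ (b ∷_))
      ≈⟨ +-comm _ _ ⟩
    ∑ (permutations A) (f ∘ (b ∷_)) + ∑ (picks A) (λ p → insertionSum b (proj₂ p) (f ∘ (proj₁ p ∷_)))
      ≈⟨ +-cong (∑-subsetsWithCompl-null₁ A (H []))
                (∑-subsetsWithCompl-picks A (λ a T S → ∑ (permutations T) (λ u → H (a ∷ u) S))) ⟨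
    ∑ (subsetsWithCompl A) (λ q → [ null (proj₁ q) ]· H [] (proj₂ q))
      + ∑ (subsetsWithCompl A) (λ q → ∑ (picks (proj₁ q)) (λ p →
          ∑ (permutations (proj₂ p)) (λ u → H (proj₁ p ∷ u) (proj₂ q))))
      ≈⟨ trans (∑-cong (subsetsWithCompl A) (λ q → ∑-permutations (proj₁ q) (λ u → H u (proj₂ q))))
               (∑-+ (subsetsWithCompl A) _ _) ⟨
    insertionSum b A f ∎
    where
    H : List X → List X → Carrier
    H u S = ∑ (permutations S) (λ v → f (u ++ b ∷ v))
    insertInRest : (j : ℕ) → length A ≡ j → ∀ {p} → suc (length (proj₂ p)) ≡ length A →
                   ∑ (arrangements j (proj₂ p ++ [ b ])) (f ∘ (proj₁ p ∷_))
                     ≈ insertionSum b (proj₂ p) (f ∘ (proj₁ p ∷_))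
    insertInRest zero    |A|≡0   e = contradiction (≡.trans e |A|≡0) λ ()
    insertInRest (suc j) |A|≡1+j {p} e =
      ∑-arrangements-∷ʳ b j {proj₂ p} (ℕₚ.suc-injective (≡.trans e |A|≡1+j)) (f ∘ (proj₁ p ∷_))

  ∑-permutations-∷ʳ : (b : X) (A : List X) (f : List X → Carrier) →
                      ∑ (permutations (A ++ [ b ])) f ≈ insertionSum b A f
  ∑-permutations-∷ʳ b A f = trans
    (reflexive (≡.cong (λ k → ∑ (arrangements k (A ++ [ b ])) f) (≡.trans (length-++ A) (ℕₚ.+-comm (length A) 1))))
    (∑-arrangements-∷ʳ b (length A) {A} ≡.refl f)

module _ {X : Set} (_≟_ : DecidableEquality X) where

  without : X → List X → List X
  without a = filter (λ b → ¬? (a ≟ b))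

  fresh : X → List X → Bool
  fresh a w = does (All.all? (λ b → ¬? (a ≟ b)) w)

  picks-unique : {A : List X} → Unique A → picks A ≡ map (λ a → a , without a A) A
  picks-unique {[]}    _              = ≡.refl
  picks-unique {a ∷ A} (a∉A ∷ uniqA) = ≡.cong₂ _∷_ head (≡.trans (≡.cong (map _) (picks-unique uniqA)) tail)
    where
    head : (a , A) ≡ (a , without a (a ∷ A))
    head = ≡.cong (a ,_) (≡.sym (≡.trans (filter-reject (λ b → ¬? (a ≟ b)) (λ a≢a → a≢a ≡.refl))
                                         (filter-all (λ b → ¬? (a ≟ b)) a∉A)))
    tail : map (map₂ (a ∷_)) (map (λ b → b , without b A) A) ≡ map (λ b → b , without b (a ∷ A)) A
    tail = ≡.trans (≡.sym (map-∘ A)) (map-cong-local (All.map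
      (λ a≢b → ≡.cong (_ ,_) (≡.sym (filter-accept (λ c → ¬? (_ ≟ c)) (a≢b ∘ ≡.sym)))) a∉A))

  module _ {c ℓ : Level} (R : CommutativeSemiring c ℓ) where
    open CommutativeSemiring R
    open Sums R
    open Arrangements R
    open import Relation.Binary.Reasoning.Setoid setoid

    -- On a cons, `fresh a (b ∷ w)` computes to `a ≢ b ∧ fresh a w` and `unique? (a ∷ w)` to `fresh a w ∧ unique? w`.
    ∑-wordsOver-fresh : (a : X) (k : ℕ) (A : List X) (H : List X → Carrier) →
                        ∑ (wordsOver k A) (λ w → [ fresh a w ]· H w) ≈ ∑ (wordsOver k (without a A)) H
    ∑-wordsOver-fresh a zero    A H = refl
    ∑-wordsOver-fresh a (suc k) A H = begin
      ∑ (wordsOver (suc k) A) (λ w → [ fresh a w ]· H w)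
        ≈⟨ ∑-concatMap _ (wordsOver k A) _ ⟩
      ∑ (wordsOver k A) (λ w → ∑ (map (_∷ w) A) (λ w → [ fresh a w ]· H w))
        ≈⟨ ∑-cong (wordsOver k A) (λ w → trans (reflexive (∑-map (_∷ w) A _)) (extend w)) ⟩
      ∑ (wordsOver k A) (λ w → [ fresh a w ]· ∑ (without a A) (λ b → H (b ∷ w)))
        ≈⟨ ∑-wordsOver-fresh a k A _ ⟩
      ∑ (wordsOver k (without a A)) (λ w → ∑ (without a A) (λ b → H (b ∷ w)))
        ≈⟨ ∑-cong (wordsOver k (without a A)) (λ w → reflexive (∑-map (_∷ w) (without a A) H)) ⟨
      ∑ (wordsOver k (without a A)) (λ w → ∑ (map (_∷ w) (without a A)) H)
        ≈⟨ ∑-concatMap _ (wordsOver k (without a A)) H ⟨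
      ∑ (wordsOver (suc k) (without a A)) H ∎
      where
      extend : (w : List X) →
               ∑ A (λ b → [ fresh a (b ∷ w) ]· H (b ∷ w)) ≈ [ fresh a w ]· ∑ (without a A) (λ b → H (b ∷ w))
      extend w = begin
        ∑ A (λ b → [ fresh a (b ∷ w) ]· H (b ∷ w))
          ≈⟨ ∑-cong A (λ b → reflexive ([∧]· (does (¬? (a ≟ b))) (fresh a w) (H (b ∷ w)))) ⟩
        ∑ A (λ b → [ does (¬? (a ≟ b)) ]· [ fresh a w ]· H (b ∷ w))
          ≈⟨ ∑-filter (λ b → ¬? (a ≟ b)) A _ ⟨
        ∑ (without a A) (λ b → [ fresh a w ]· H (b ∷ w))
          ≈⟨ ∑-[]· (fresh a w) (without a A) _ ⟩
        [ fresh a w ]· ∑ (without a A) (λ b → H (b ∷ w)) ∎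

    ∑-unique-wordsOver : (k : ℕ) {A : List X} → Unique A → (F : List X → Carrier) →
                         ∑ (filter (UniqueDec.unique? _≟_) (wordsOver k A)) F ≈ ∑ (arrangements k A) F
    ∑-unique-wordsOver zero    uniqA F = refl
    ∑-unique-wordsOver (suc k) {A} uniqA F = begin
      ∑ (filter unique? (wordsOver (suc k) A)) F
        ≈⟨ ∑-filter unique? (wordsOver (suc k) A) F ⟩
      ∑ (wordsOver (suc k) A) (λ w → [ does (unique? w) ]· F w)
        ≈⟨ ∑-concatMap _ (wordsOver k A) _ ⟩
      ∑ (wordsOver k A) (λ w → ∑ (map (_∷ w) A) (λ w → [ does (unique? w) ]· F w))
        ≈⟨ ∑-cong (wordsOver k A) (λ w → trans (reflexive (∑-map (_∷ w) A _))
             (∑-cong A (λ a → reflexive ([∧]· (fresh a w) (does (unique? w)) (F (a ∷ w)))))) ⟩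
      ∑ (wordsOver k A) (λ w → ∑ A (λ a → [ fresh a w ]· [ does (unique? w) ]· F (a ∷ w)))
        ≈⟨ ∑-swap (wordsOver k A) A _ ⟩
      ∑ A (λ a → ∑ (wordsOver k A) (λ w → [ fresh a w ]· [ does (unique? w) ]· F (a ∷ w)))
        ≈⟨ ∑-cong A (λ a → ∑-wordsOver-fresh a k A _) ⟩
      ∑ A (λ a → ∑ (wordsOver k (without a A)) (λ w → [ does (unique? w) ]· F (a ∷ w)))
        ≈⟨ ∑-cong A (λ a → ∑-filter unique? (wordsOver k (without a A)) _) ⟨
      ∑ A (λ a → ∑ (filter unique? (wordsOver k (without a A))) (λ w → F (a ∷ w)))
        ≈⟨ ∑-cong A (λ a → ∑-unique-wordsOver k (Unique.filter⁺ (λ b → ¬? (a ≟ b)) uniqA) _) ⟩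
      ∑ A (λ a → ∑ (arrangements k (without a A)) (λ w → F (a ∷ w)))
        ≡⟨ ∑-map (λ a → a , without a A) A _ ⟨
      ∑ (map (λ a → a , without a A) A) (λ p → ∑ (arrangements k (proj₂ p)) (λ w → F (proj₁ p ∷ w)))
        ≡⟨ ≡.cong (λ l → ∑ l (λ p → ∑ (arrangements k (proj₂ p)) (λ w → F (proj₁ p ∷ w)))) (picks-unique uniqA) ⟨
      ∑ (picks A) (λ p → ∑ (arrangements k (proj₂ p)) (λ w → F (proj₁ p ∷ w)))
        ≈⟨ ∑-arrangements-suc k A F ⟨
      ∑ (arrangements (suc k) A) F ∎
      where unique? = UniqueDec.unique? _≟_

module Peaks {c ℓ : Level} (R : CommutativeSemiring c ℓ) (x : ℕ → CommutativeSemiring.Carrier R) where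
  open CommutativeSemiring R
  open WithSemiring R
  open Sums R
  open Arrangements R
  open import Algebra.Properties.CommutativeSemigroup *-commutativeSemigroup using (x∙yz≈y∙xz)
  open import Relation.Binary.Reasoning.Setoid setoid

  peakProdℕ : List ℕ → Carrier
  peakProdℕ (a ∷ b ∷ c ∷ rest) =
    (if does (a <? b) ∧ does (c <? b) then x b else 1#) * peakProdℕ (b ∷ c ∷ rest)
  peakProdℕ _                  = 1#

  peakSum : List ℕ → Carrier
  peakSum L = ∑ (permutations L) peakProdℕ

  module _ {m : ℕ} (y : Fin m → Carrier) (g : Fin m → ℕ) (y≡x∘g : ∀ i → y i ≡ x (g i))
           (g-mono : ∀ {i j} → i Fin.< j → g i < g j) where

    g-reflects-< : ∀ {i j} → g i < g j → i Fin.< j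
    g-reflects-< {i} {j} gi<gj with Finₚ.<-cmp i j
    ... | tri< i<j _ _    = i<j
    ... | tri≈ _ ≡.refl _ = contradiction gi<gj (ℕₚ.<-irrefl ≡.refl)
    ... | tri> _ _ j<i    = contradiction gi<gj (ℕₚ.<-asym (g-mono j<i))

    does-<-relabel : ∀ i j → does (i Fin.<? j) ≡ does (g i <? g j)
    does-<-relabel i j = does-⇔ (mk⇔ g-mono g-reflects-<) (i Fin.<? j) (g i <? g j)

    peakProd-relabel : (w : List (Fin m)) → peakProd y w ≡ peakProdℕ (map g w)
    peakProd-relabel (a ∷ b ∷ c ∷ rest) = ≡.cong₂ _*_
      (≡.cong₂ (λ p v → if p then v else 1#)
               (≡.cong₂ _∧_ (does-<-relabel a b) (does-<-relabel c b)) (y≡x∘g b))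
      (peakProd-relabel (b ∷ c ∷ rest))
    peakProd-relabel []          = ≡.refl
    peakProd-relabel (_ ∷ [])     = ≡.refl
    peakProd-relabel (_ ∷ _ ∷ []) = ≡.refl

  entry : (L : List ℕ) → Fin (length (map x L)) → ℕ
  entry (a ∷ L) Fin.zero    = a
  entry (a ∷ L) (Fin.suc i) = entry L i

  lookup-map-entry : (L : List ℕ) (i : Fin (length (map x L))) → lookup (map x L) i ≡ x (entry L i)
  lookup-map-entry (a ∷ L) Fin.zero    = ≡.refl
  lookup-map-entry (a ∷ L) (Fin.suc i) = lookup-map-entry L i

  entry-All : {P : ℕ → Set} {L : List ℕ} → All P L → ∀ i → P (entry L i)
  entry-All (pa ∷ _)   Fin.zero    = pa
  entry-All (_ ∷ pas) (Fin.suc i) = entry-All pas i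

  entry-mono : {L : List ℕ} → AllPairs _<_ L → ∀ {i j} → i Fin.< j → entry L i < entry L j
  entry-mono (a<L ∷ _)  {Fin.zero}  {Fin.suc j} _       = entry-All a<L j
  entry-mono (_ ∷ sorted) {Fin.suc i} {Fin.suc j} (s<s i<j) = entry-mono sorted i<j

  tabulate-entry : (L : List ℕ) → tabulate (entry L) ≡ L
  tabulate-entry []      = ≡.refl
  tabulate-entry (a ∷ L) = ≡.cong (a ∷_) (tabulate-entry L)

  Bhat≈peakSum : {L : List ℕ} → AllPairs _<_ L → Bhat (map x L) ≈ peakSum L
  Bhat≈peakSum {L} sorted = begin
    Bhat (map x L)
      ≡⟨ ≡.cong (λ ws → ∑ (filter (UniqueDec.unique? Finₚ._≟_) ws) (peakProd y)) (words≡wordsOver m m) ⟩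
    ∑ (filter (UniqueDec.unique? Finₚ._≟_) (wordsOver m (allFin m))) (peakProd y)
      ≈⟨ ∑-unique-wordsOver Finₚ._≟_ R m (Unique.allFin⁺ m) _ ⟩
    ∑ (arrangements m (allFin m)) (peakProd y)
      ≈⟨ ∑-cong (arrangements m (allFin m))
                (reflexive ∘ peakProd-relabel y (entry L) (lookup-map-entry L) (entry-mono sorted)) ⟩
    ∑ (arrangements m (allFin m)) (peakProdℕ ∘ map (entry L))
      ≈⟨ ∑-arrangements-map (entry L) m (allFin m) peakProdℕ ⟨
    ∑ (arrangements m (map (entry L) (allFin m))) peakProdℕ
      ≡⟨ ≡.cong (λ A → ∑ (arrangements m A) peakProdℕ) (≡.trans (map-tabulate id (entry L)) (tabulate-entry L)) ⟩
    ∑ (arrangements m L) peakProdℕ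
      ≡⟨ ≡.cong (λ k → ∑ (arrangements k L) peakProdℕ) (length-map x L) ⟩
    peakSum L ∎
    where
    m = length (map x L)
    y = lookup (map x L)

  module _ (n : ℕ) where

    peakProdℕ-max∷ : {v : List ℕ} → All (_< n) v → peakProdℕ (n ∷ v) ≈ peakProdℕ v
    peakProdℕ-max∷ []                      = refl
    peakProdℕ-max∷ (_ ∷ [])                = refl
    peakProdℕ-max∷ {c ∷ d ∷ _} (c<n ∷ _) = trans
      (*-cong (reflexive (≡.cong (λ b → if b ∧ does (d <? c) then x c else 1#) (dec-false (n <? c) (ℕₚ.<-asym c<n))))
              refl)
      (*-identityˡ _)

    -- After a nonempty prefix, n is a peak exactly when something follows it.
    rightWeight : List ℕ → Carrier
    rightWeight []      = 1#
    rightWeight (c ∷ v) = x n * peakProdℕ (c ∷ v)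

    rightWeight-nonempty : {v : List ℕ} → null v ≡ false → rightWeight v ≡ x n * peakProdℕ v
    rightWeight-nonempty {_ ∷ _} _ = ≡.refl

    peakProdℕ-++-max∷ : {u v : List ℕ} → null u ≡ false → All (_< n) u → All (_< n) v →
                        peakProdℕ (u ++ n ∷ v) ≈ peakProdℕ u * rightWeight v
    peakProdℕ-++-max∷ {p ∷ []} {[]}    _ _ _ = sym (*-identityˡ _)
    peakProdℕ-++-max∷ {p ∷ []} {c ∷ v} _ (p<n ∷ []) (c<n ∷ v<n) = begin
      (if does (p <? n) ∧ does (c <? n) then x n else 1#) * peakProdℕ (n ∷ c ∷ v)
        ≡⟨ ≡.cong₂ (λ b₁ b₂ → (if b₁ ∧ b₂ then x n else 1#) * peakProdℕ (n ∷ c ∷ v))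
                   (dec-true (p <? n) p<n) (dec-true (c <? n) c<n) ⟩
      x n * peakProdℕ (n ∷ c ∷ v)  ≈⟨ *-cong refl (peakProdℕ-max∷ (c<n ∷ v<n)) ⟩
      x n * peakProdℕ (c ∷ v)      ≈⟨ *-identityˡ _ ⟨
      1# * rightWeight (c ∷ v)      ∎
    peakProdℕ-++-max∷ {p ∷ q ∷ []} {v} _ (_ ∷ q<n ∷ []) v<n = begin
      (if does (p <? q) ∧ does (n <? q) then x q else 1#) * peakProdℕ (q ∷ n ∷ v)
        ≡⟨ ≡.cong (λ b → (if b then x q else 1#) * peakProdℕ (q ∷ n ∷ v))
                  (≡.trans (≡.cong (does (p <? q) ∧_) (dec-false (n <? q) (ℕₚ.<-asym q<n))) (∧-zeroʳ _)) ⟩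
      1# * peakProdℕ (q ∷ n ∷ v)    ≈⟨ *-cong refl (peakProdℕ-++-max∷ ≡.refl (q<n ∷ []) v<n) ⟩
      1# * (1# * rightWeight v)     ≈⟨ *-cong refl (*-identityˡ _) ⟩
      1# * rightWeight v            ∎
    peakProdℕ-++-max∷ {p ∷ q ∷ r ∷ u} _ (_ ∷ qru<n) v<n =
      trans (*-cong refl (peakProdℕ-++-max∷ ≡.refl qru<n v<n)) (sym (*-assoc _ _ _))

    splitWeight : List ℕ → List ℕ → Carrier
    splitWeight []      S       = peakSum S
    splitWeight (t ∷ T) []      = peakSum (t ∷ T)
    splitWeight (t ∷ T) (s ∷ S) = x n * (peakSum (t ∷ T) * peakSum (s ∷ S))

    ∑-permutations-++-max∷ : {T S : List ℕ} → All (_< n) T → All (_< n) S →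
      ∑ (permutations T) (λ u → ∑ (permutations S) (λ v → peakProdℕ (u ++ n ∷ v))) ≈ splitWeight T S
    ∑-permutations-++-max∷ {[]} {S} _ S<n =
      trans (+-identityʳ _) (∑-congᴬ (All.map peakProdℕ-max∷ (arrangements-All (length S) S<n)))
    ∑-permutations-++-max∷ {t ∷ T} {S} T<n S<n = begin
      ∑ (permutations (t ∷ T)) (λ u → ∑ (permutations S) (λ v → peakProdℕ (u ++ n ∷ v)))
        ≈⟨ ∑-congᴬ (All.map (λ (u≢[] , u<n) → ∑-right u≢[] u<n)
                             (All.zip (arrangements-nonempty (length T) (t ∷ T) , arrangements-All (suc (length T)) T<n))) ⟩
      ∑ (permutations (t ∷ T)) (λ u → peakProdℕ u * ∑ (permutations S) rightWeight)
        ≈⟨ ∑-*ʳ _ (permutations (t ∷ T)) peakProdℕ ⟨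
      peakSum (t ∷ T) * ∑ (permutations S) rightWeight
        ≈⟨ peakSum-*-∑-rightWeight S ⟩
      splitWeight (t ∷ T) S ∎
      where
      ∑-right : {u : List ℕ} → null u ≡ false → All (_< n) u →
                ∑ (permutations S) (λ v → peakProdℕ (u ++ n ∷ v)) ≈ peakProdℕ u * ∑ (permutations S) rightWeight
      ∑-right u≢[] u<n = trans (∑-congᴬ (All.map (peakProdℕ-++-max∷ u≢[] u<n) (arrangements-All (length S) S<n)))
                               (sym (∑-*ˡ _ (permutations S) rightWeight))
      peakSum-*-∑-rightWeight : (S : List ℕ) →
                                peakSum (t ∷ T) * ∑ (permutations S) rightWeight ≈ splitWeight (t ∷ T) S
      peakSum-*-∑-rightWeight []      = trans (*-cong refl (+-identityʳ _)) (*-identityʳ _)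
      peakSum-*-∑-rightWeight (s ∷ S) = begin
        peakSum (t ∷ T) * ∑ (permutations (s ∷ S)) rightWeight
          ≈⟨ *-cong refl (∑-congᴬ (All.map (reflexive ∘ rightWeight-nonempty) (arrangements-nonempty (length S) (s ∷ S)))) ⟩
        peakSum (t ∷ T) * ∑ (permutations (s ∷ S)) (λ v → x n * peakProdℕ v)
          ≈⟨ *-cong refl (∑-*ˡ _ (permutations (s ∷ S)) peakProdℕ) ⟨
        peakSum (t ∷ T) * (x n * peakSum (s ∷ S))
          ≈⟨ x∙yz≈y∙xz _ _ _ ⟩
        x n * (peakSum (t ∷ T) * peakSum (s ∷ S)) ∎

module Recurrence {c ℓ : Level} (R : CommutativeSemiring c ℓ) (x : ℕ → CommutativeSemiring.Carrier R) (k : ℕ) where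
  open CommutativeSemiring R
  open WithSemiring R
  open Sums R
  open Arrangements R
  open Peaks R x
  open import Relation.Binary.Reasoning.Setoid setoid

  n : ℕ
  n = suc (suc k)

  A : List ℕ
  A = interval 1 (suc k)

  A↑ : AllPairs _<_ A
  A↑ = interval-sorted 1 (suc k)

  innerWeight : List ℕ × List ℕ → Carrier
  innerWeight ([]    , _)     = 0#
  innerWeight (_ ∷ _ , [])    = 0#
  innerWeight (T     , S)     = Bhat (map x T) * Bhat (map x S)

  sizeWeight : ℕ → List ℕ × List ℕ → Carrier
  sizeWeight j (T , S) = [ length T ≡ᵇ j ∸ 1 ]· (Bhat (map x T) * Bhat (map x S))

  splitWeight-decompose : {T S : List ℕ} → AllPairs _<_ T → AllPairs _<_ S →
    splitWeight n T S ≈ [ null T ]· peakSum S + ([ null S ]· [ not (null T) ]· peakSum T + x n * innerWeight (T , S))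
  splitWeight-decompose {[]}    {[]}    _ _ = sym (trans (+-cong refl (trans (+-identityˡ _) (zeroʳ _))) (+-identityʳ _))
  splitWeight-decompose {[]}    {_ ∷ _} _ _ = sym (trans (+-cong refl (trans (+-identityˡ _) (zeroʳ _))) (+-identityʳ _))
  splitWeight-decompose {_ ∷ _} {[]}    _ _ = sym (trans (+-identityˡ _) (trans (+-cong refl (zeroʳ _)) (+-identityʳ _)))
  splitWeight-decompose {_ ∷ _} {_ ∷ _} T↑ S↑ =
    sym (trans (+-identityˡ _) (trans (+-identityˡ _) (*-cong refl (*-cong (Bhat≈peakSum T↑) (Bhat≈peakSum S↑)))))

  Bhat-by-position-of-max :
    Bhat (map x (interval 1 n)) ≈ peakSum A + (peakSum A + ∑ (subsetsWithCompl A) (λ q → x n * innerWeight q))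
  Bhat-by-position-of-max = begin
    Bhat (map x (interval 1 n))
      ≈⟨ Bhat≈peakSum (interval-sorted 1 n) ⟩
    peakSum (interval 1 n)
      ≡⟨ ≡.cong peakSum (applyUpTo-∷ʳ suc (suc k)) ⟨
    peakSum (A ++ [ n ])
      ≈⟨ ∑-permutations-∷ʳ n A peakProdℕ ⟩
    insertionSum n A peakProdℕ
      ≈⟨ ∑-congᴬ (All.map (λ (T<n , S<n) → ∑-permutations-++-max∷ n T<n S<n) (subsetsWithCompl-All A<n)) ⟩
    ∑ (subsetsWithCompl A) (λ q → splitWeight n (proj₁ q) (proj₂ q))
      ≈⟨ ∑-congᴬ (All.map (λ (T↑ , S↑) → splitWeight-decompose T↑ S↑) (subsetsWithCompl-AllPairs A↑)) ⟩
    ∑ (subsetsWithCompl A) (λ q → [ null (proj₁ q) ]· peakSum (proj₂ q)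
                                  + ([ null (proj₂ q) ]· [ not (null (proj₁ q)) ]· peakSum (proj₁ q) + x n * innerWeight q))
      ≈⟨ trans (∑-+ (subsetsWithCompl A) _ _) (+-cong refl (∑-+ (subsetsWithCompl A) _ _)) ⟩
    ∑ (subsetsWithCompl A) (λ q → [ null (proj₁ q) ]· peakSum (proj₂ q))
      + (∑ (subsetsWithCompl A) (λ q → [ null (proj₂ q) ]· [ not (null (proj₁ q)) ]· peakSum (proj₁ q))
         + ∑ (subsetsWithCompl A) (λ q → x n * innerWeight q))
      ≈⟨ +-cong (∑-subsetsWithCompl-null₁ A peakSum)
                (+-cong (∑-subsetsWithCompl-null₂ A (λ T → [ not (null T) ]· peakSum T)) refl) ⟩
    peakSum A + (peakSum A + ∑ (subsetsWithCompl A) (λ q → x n * innerWeight q)) ∎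
    where
    A<n : All (_< n) A
    A<n = All.applyUpTo⁺₁ suc (suc k) s<s

  ∑-sizes≈innerWeight : All (λ q → ∑ (interval 2 k) (λ j → sizeWeight j q) ≈ innerWeight q) (subsetsWithCompl A)
  ∑-sizes≈innerWeight =
    All.map (λ {q} e → bySizes {proj₁ q} {proj₂ q} (≡.trans e (length-applyUpTo (1 ℕ.+_) (suc k))))
            (subsetsWithCompl-length A)
    where
    bySizes : {T S : List ℕ} → length T ℕ.+ length S ≡ suc k →
              ∑ (interval 2 k) (λ j → sizeWeight j (T , S)) ≈ innerWeight (T , S)
    bySizes {[]}    {_}     _ = ∑-interval-[≡ᵇ]-outside k _ (inj₁ z<s)
    bySizes {_ ∷ T} {[]}    e = ∑-interval-[≡ᵇ]-outside k _ (inj₂ (ℕₚ.≤-reflexive (≡.trans (≡.sym e) (ℕₚ.+-identityʳ _))))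
    bySizes {_ ∷ T} {_ ∷ S} e = ∑-interval-[≡ᵇ]-inside k _ (s≤s z≤n)
      (s≤s (≡.subst (suc (length T) ≤_) (ℕₚ.suc-injective e) (ℕₚ.m<m+n (length T) z<s)))

lemma4p1 : {c ℓ : Level} (R : CommutativeSemiring c ℓ) →
    let open CommutativeSemiring R
        open WithSemiring R
    in (x : ℕ → Carrier) (n : ℕ) → 2 ≤ n →
       Bhat (map x (interval 1 n))
         ≈ (1# + 1#) * Bhat (map x (interval 1 (n ∸ 1)))
           + x n * sumL (map (λ k → sumL (map (λ { (T , S) →
                      if length T ≡ᵇ (k ∸ 1)
                      then Bhat (map x T) * Bhat (map x S)
                      else 0# })
                    (subsetsWithCompl (interval 1 (n ∸ 1)))))
                  (interval 2 (n ∸ 2)))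
lemma4p1 R x (suc (suc k)) (s≤s (s≤s z≤n)) = begin
  Bhat (map x (interval 1 n))
    ≈⟨ Bhat-by-position-of-max ⟩
  peakSum A + (peakSum A + ∑ (subsetsWithCompl A) (λ q → x n * innerWeight q))
    ≈⟨ trans (+-cong (+-cong (Bhat≈peakSum A↑) (Bhat≈peakSum A↑)) (∑-*ˡ (x n) (subsetsWithCompl A) _)) (+-assoc _ _ _) ⟨
  (Bhat (map x A) + Bhat (map x A)) + x n * ∑ (subsetsWithCompl A) innerWeight
    ≈⟨ +-cong twice (*-cong refl (sym (∑-congᴬ ∑-sizes≈innerWeight))) ⟩
  (1# + 1#) * Bhat (map x A) + x n * ∑ (subsetsWithCompl A) (λ q → ∑ (interval 2 k) (λ j → sizeWeight j q))
    ≈⟨ +-cong refl (*-cong refl (∑-swap (subsetsWithCompl A) (interval 2 k) (λ q j → sizeWeight j q))) ⟩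
  (1# + 1#) * Bhat (map x A) + x n * ∑ (interval 2 k) (λ j → ∑ (subsetsWithCompl A) (sizeWeight j)) ∎
  where
  open CommutativeSemiring R
  open WithSemiring R
  open Sums R
  open Peaks R x
  open Recurrence R x k
  open import Relation.Binary.Reasoning.Setoid setoid
  twice : Bhat (map x A) + Bhat (map x A) ≈ (1# + 1#) * Bhat (map x A)
  twice = sym (trans (distribʳ _ _ _) (+-cong (*-identityˡ _) (*-identityˡ _)))
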